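{- Let $L\ge2$ and $n\ge2$ be integers. Then $\xi_{m+1}(K_L^n)-\xi_m(K_L^n)\ge 0$ for every integer $1\le m<L^{\lfloor n/2\rfloor}$.
   Context: $K_L^n$ is the graph on strings $x_n\cdots x_1$ over $\{0,\dots,L-1\}$, adjacent iff they differ in exactly one coordinate. For an integer $0\le m\le L^n$ with base-$L$ expansion $m=\sum_{i=0}^{s}a_iL^{b_i}$ ($a_i\in\{1,\dots,L-1\}$, $b_0>\dots>b_s\ge0$) let $ex_m(K_L^n)=\sum_{i=0}^{s}[(L-1)a_ib_iL^{b_i}+(a_i-1)a_iL^{b_i}]+2\sum_{i=0}^{s-1}\sum_{k=i+1}^{s}a_ia_kL^{b_k}$ ($ex_0=0$), and $\xi_m(K_L^n)=(L-1)nm-ex_m(K_L^n)$. (Known facts: $ex_m(K_L^n)$ is the maximum of $2|E(K_L^n[X])|$ over $|X|=m$, and for $1\le m\le\lfloor L^n/2\rfloor$, $\xi_m(K_L^n)$ equals the minimum of $|[X,\overline X]|$ over $X\subset V(K_L^n)$ with $|X|=m$ such that both $K_L^n[X]$ and $K_L^n[\overline X]$ are connected.) -}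

module Defs where

open import Data.Nat using (ℕ; zero; suc; _+_; _*_; _∸_; _^_; NonZero)
open import Data.Nat.DivMod using (_/_; _%_)
open import Data.List using (List; []; _∷_; reverse)
open import Data.Product using (_×_; _,_)
open import Data.Integer as ℤ using (ℤ; +_)

-- Base-L expansion of m: the list of pairs (a_i , b_i) with a_i ∈ {1,…,L-1}
-- the nonzero digits and b_i the corresponding exponents, so that
-- m = Σ a_i L^{b_i}.  'digitsAux fuel m pos' produces them in INCREASING
-- order of exponent (fuel ≥ m suffices, since every step divides m by L ≥ 2).
digitsAux : (L : ℕ) → .{{NonZero L}} → (fuel m pos : ℕ) → List (ℕ × ℕ)
digitsAux L zero    m pos = []
digitsAux L (suc f) zero pos = []
digitsAux L (suc f) (suc m) pos with suc m % L
... | zero  = digitsAux L f (suc m / L) (suc pos)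
... | suc d = (suc d , pos) ∷ digitsAux L f (suc m / L) (suc pos)

-- Nonzero digits in DECREASING order of exponent: b_0 > b_1 > … > b_s.
expansion : (L : ℕ) → .{{NonZero L}} → ℕ → List (ℕ × ℕ)
expansion L m = reverse (digitsAux L m m 0)

tailSum : (L : ℕ) → List (ℕ × ℕ) → ℕ
tailSum L [] = 0
tailSum L ((a , b) ∷ rest) = a * L ^ b + tailSum L rest

exList : (L : ℕ) → List (ℕ × ℕ) → ℕ
exList L [] = 0
exList L ((a , b) ∷ rest) =
  (L ∸ 1) * a * b * L ^ b + (a ∸ 1) * a * L ^ b
  + 2 * a * tailSum L rest
  + exList L rest

-- ex_m(K_L^n)  (independent of n; ex_0 = 0 since the expansion of 0 is empty)
ex : (L : ℕ) → .{{NonZero L}} → ℕ → ℕ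
ex L m = exList L (expansion L m)

ξ : (L : ℕ) → .{{NonZero L}} → (n m : ℕ) → ℤ
ξ L n m = (+ ((L ∸ 1) * n * m)) ℤ.- (+ (ex L m))

{-# OPTIONS --safe #-}
-- Splitting off the units digit r of m = r + q L gives a recursion for ex in q and r, from which
-- ex_{m+1} = ex_m + 2 s(m), with s(m) the base-L digit sum of m: directly when r < L − 1, and by
-- strong induction on m (through ex_{q+1} = ex_q + 2 s(q)) when the increment carries.  Hence
-- ξ_{m+1} − ξ_m = (L − 1) n − 2 s(m), and a number m < L^⌊n/2⌋ has at most ⌊n/2⌋ digits, each at
-- most L − 1, so 2 s(m) ≤ (L − 1) n.
module Submission where

open import Defs
open import Data.Nat using (ℕ; zero; suc; _+_; _*_; _∸_; _^_; _≤_; _<_; NonZero; z≤n; s≤s)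
open import Data.Nat.Properties
open import Data.Nat.DivMod
  using (_/_; _%_; m≡m%n+[m/n]*n; m%n<n; m/n<m; [m+kn]%n≡m%n; m<n⇒m%n≡m; +-distrib-/; m*n%n≡0;
         m<n⇒m/n≡0; m*n/n≡m; m<n*o⇒m/o<n; m/n*n≤m)
open import Data.Nat.Induction using (<-rec)
open import Data.Nat.Tactic.RingSolver using (solve-∀)
import Data.Integer as ℤ
import Data.Integer.Properties as ℤP
import Data.Integer.Tactic.RingSolver as ℤ-Solver
open import Data.List using (List; []; _∷_; _++_; map; reverse; [_])
open import Data.List.Properties using (unfold-reverse; reverse-map; ++-identityʳ)
open import Data.Product using (_×_; _,_)
open import Data.Sum using (inj₁; inj₂)
open import Function using (_∘_)
open import Relation.Binary.PropositionalEquality using (_≡_; refl; sym; trans; cong; cong₂; subst; module ≡-Reasoning)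

shiftExponent : ℕ × ℕ → ℕ × ℕ
shiftExponent (a , b) = a , suc b

unitsDigit : ℕ → List (ℕ × ℕ)
unitsDigit zero    = []
unitsDigit (suc d) = [ (suc d , 0) ]

sumDigits : List (ℕ × ℕ) → ℕ
sumDigits []             = 0
sumDigits ((a , _) ∷ ds) = a + sumDigits ds

sumDigits-++ : ∀ ds es → sumDigits (ds ++ es) ≡ sumDigits ds + sumDigits es
sumDigits-++ []             es = refl
sumDigits-++ ((a , _) ∷ ds) es = trans (cong (a +_) (sumDigits-++ ds es)) (sym (+-assoc a _ _))

sumDigits-shift : ∀ ds → sumDigits (map shiftExponent ds) ≡ sumDigits ds
sumDigits-shift []             = refl
sumDigits-shift ((a , _) ∷ ds) = cong (a +_) (sumDigits-shift ds)

sumDigits-unitsDigit : ∀ r → sumDigits (unitsDigit r) ≡ r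
sumDigits-unitsDigit zero    = refl
sumDigits-unitsDigit (suc d) = +-identityʳ (suc d)

private
  tailSum-shift-identity : ∀ L a p t → a * (L * p) + L * t ≡ L * (a * p + t)
  tailSum-shift-identity = solve-∀

  exList-++-identity : ∀ x a t t′ e e′ d →
    x + 2 * a * (t + t′) + (e + e′ + 2 * d * t′) ≡ x + 2 * a * t + e + e′ + 2 * (a + d) * t′
  exList-++-identity = solve-∀

  exList-shift-identity : ∀ L ℓ a b p d t e →
    ℓ * a * (1 + b) * (L * p) + d * a * (L * p) + 2 * a * (L * t) + (L * e + ℓ * L * t)
      ≡ L * (ℓ * a * b * p + d * a * p + 2 * a * t + e) + ℓ * L * (a * p + t)
  exList-shift-identity = solve-∀

  exList-unitsDigit-identity : ∀ ℓ d → ℓ * (1 + d) * 0 * 1 + d * (1 + d) * 1 + 2 * (1 + d) * 0 + 0 ≡ d * (1 + d)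
  exList-unitsDigit-identity = solve-∀

  r*[1+r]≡[r∸1]*r+2r : ∀ r → r * suc r ≡ (r ∸ 1) * r + 2 * r
  r*[1+r]≡[r∸1]*r+2r zero    = refl
  r*[1+r]≡[r∸1]*r+2r (suc r) = identity r
    where
    identity : ∀ r → (1 + r) * (2 + r) ≡ r * (1 + r) + 2 * (1 + r)
    identity = solve-∀

  no-carry-identity : ∀ a u s r → a + (u + 2 * r) + 2 * s * (1 + r) ≡ a + u + 2 * s * r + 2 * (r + s)
  no-carry-identity = solve-∀

  -- The carry from ℓ + q L to (1 + q) L, where L = 2 + k and ℓ = L − 1 = 1 + k.
  carry-identity : ∀ k q e s s′ →
    (2 + k) * (e + 2 * s) + (1 + k) * (2 + k) * (1 + q) + 0 + 2 * s′ * 0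
      ≡ (2 + k) * e + (1 + k) * (2 + k) * q + k * (1 + k) + 2 * s * (1 + k) + 2 * ((1 + k) + s)
  carry-identity = solve-∀

  difference-identity : ∀ a b c e → (a ℤ.+ c ℤ.- (e ℤ.+ b)) ℤ.- (c ℤ.- e) ≡ a ℤ.- b
  difference-identity = ℤ-Solver.solve-∀

module _ (L : ℕ) where

  tailSum-++ : ∀ ds es → tailSum L (ds ++ es) ≡ tailSum L ds + tailSum L es
  tailSum-++ []             es = refl
  tailSum-++ ((a , b) ∷ ds) es = trans (cong (a * L ^ b +_) (tailSum-++ ds es)) (sym (+-assoc (a * L ^ b) _ _))

  tailSum-shift : ∀ ds → tailSum L (map shiftExponent ds) ≡ L * tailSum L ds
  tailSum-shift []             = sym (*-zeroʳ L)
  tailSum-shift ((a , b) ∷ ds) rewrite tailSum-shift ds = tailSum-shift-identity L a (L ^ b) (tailSum L ds)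

  tailSum-unitsDigit : ∀ r → tailSum L (unitsDigit r) ≡ r
  tailSum-unitsDigit zero    = refl
  tailSum-unitsDigit (suc d) = trans (+-identityʳ _) (*-identityʳ (suc d))

  exList-++ : ∀ ds es → exList L (ds ++ es) ≡ exList L ds + exList L es + 2 * sumDigits ds * tailSum L es
  exList-++ []             es = sym (+-identityʳ (exList L es))
  exList-++ ((a , b) ∷ ds) es rewrite tailSum-++ ds es | exList-++ ds es =
    exList-++-identity ((L ∸ 1) * a * b * L ^ b + (a ∸ 1) * a * L ^ b) a
      (tailSum L ds) (tailSum L es) (exList L ds) (exList L es) (sumDigits ds)

  exList-shift : ∀ ds → exList L (map shiftExponent ds) ≡ L * exList L ds + (L ∸ 1) * L * tailSum L ds
  exList-shift []             = sym (trans (cong (_+ (L ∸ 1) * L * 0) (*-zeroʳ L)) (*-zeroʳ ((L ∸ 1) * L)))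
  exList-shift ((a , b) ∷ ds) rewrite tailSum-shift ds | exList-shift ds =
    exList-shift-identity L (L ∸ 1) a b (L ^ b) (a ∸ 1) (tailSum L ds) (exList L ds)

  exList-unitsDigit : ∀ r → exList L (unitsDigit r) ≡ (r ∸ 1) * r
  exList-unitsDigit zero    = refl
  exList-unitsDigit (suc d) = exList-unitsDigit-identity (L ∸ 1) d

  digitsAux-shift : .{{_ : NonZero L}} → ∀ f m pos →
    digitsAux L f m (suc pos) ≡ map shiftExponent (digitsAux L f m pos)
  digitsAux-shift zero    m       pos = refl
  digitsAux-shift (suc f) zero    pos = refl
  digitsAux-shift (suc f) (suc m) pos with suc m % L
  ... | zero  = digitsAux-shift f (suc m / L) (suc pos)
  ... | suc d = cong ((suc d , suc pos) ∷_) (digitsAux-shift f (suc m / L) (suc pos))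

module Radix (k : ℕ) where

  L : ℕ
  L = 2 + k

  ℓ : ℕ
  ℓ = L ∸ 1

  digitSum : ℕ → ℕ
  digitSum m = sumDigits (expansion L m)

  quotient-< : ∀ m → suc m / L < suc m
  quotient-< m = m/n<m (suc m) L (s≤s (s≤s z≤n))

  quotient-≤ : ∀ {m h} → m ≤ h → suc m / L ≤ h
  quotient-≤ {m} = ≤-trans (≤-pred (quotient-< m))

  digitsAux-fuel : ∀ f g m pos → m ≤ f → m ≤ g → digitsAux L f m pos ≡ digitsAux L g m pos
  digitsAux-fuel zero    zero    zero    pos _ _ = refl
  digitsAux-fuel zero    (suc g) zero    pos _ _ = refl
  digitsAux-fuel (suc f) zero    zero    pos _ _ = refl
  digitsAux-fuel (suc f) (suc g) zero    pos _ _ = refl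
  digitsAux-fuel (suc f) (suc g) (suc m) pos (s≤s m≤f) (s≤s m≤g) with suc m % L
  ... | zero  = digitsAux-fuel f g (suc m / L) (suc pos) (quotient-≤ m≤f) (quotient-≤ m≤g)
  ... | suc d = cong ((suc d , pos) ∷_) (digitsAux-fuel f g (suc m / L) (suc pos) (quotient-≤ m≤f) (quotient-≤ m≤g))

  reverse-digitsAux-quotient : ∀ m → reverse (digitsAux L m (suc m / L) 1) ≡ map shiftExponent (expansion L (suc m / L))
  reverse-digitsAux-quotient m = begin
    reverse (digitsAux L m q 1)                     ≡⟨ cong reverse (digitsAux-shift L m q 0) ⟩
    reverse (map shiftExponent (digitsAux L m q 0)) ≡⟨ reverse-map shiftExponent (digitsAux L m q 0) ⟨
    map shiftExponent (reverse (digitsAux L m q 0)) ≡⟨ cong (map shiftExponent ∘ reverse)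
                                                        (digitsAux-fuel m q q 0 (quotient-≤ ≤-refl) ≤-refl) ⟩
    map shiftExponent (expansion L q)               ∎
    where open ≡-Reasoning
          q = suc m / L

  expansion-divMod : ∀ m → expansion L m ≡ map shiftExponent (expansion L (m / L)) ++ unitsDigit (m % L)
  expansion-divMod zero = refl
  expansion-divMod (suc m) with suc m % L
  ... | zero  = trans (reverse-digitsAux-quotient m) (sym (++-identityʳ _))
  ... | suc d = trans (unfold-reverse _ (digitsAux L m (suc m / L) 1))
                      (cong (_++ [ (suc d , 0) ]) (reverse-digitsAux-quotient m))

  /-+* : ∀ q r → r < L → (r + q * L) / L ≡ q
  /-+* q r r<L = trans (+-distrib-/ r (q * L) remainders<L) (cong₂ _+_ (m<n⇒m/n≡0 r<L) (m*n/n≡m q L))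
    where
    remainders<L : r % L + q * L % L < L
    remainders<L = subst (_< L) (sym (trans (cong₂ _+_ (m<n⇒m%n≡m r<L) (m*n%n≡0 q L)) (+-identityʳ r))) r<L

  %-+* : ∀ q r → r < L → (r + q * L) % L ≡ r
  %-+* q r r<L = trans ([m+kn]%n≡m%n r q L) (m<n⇒m%n≡m r<L)

  expansion-+* : ∀ q r → r < L → expansion L (r + q * L) ≡ map shiftExponent (expansion L q) ++ unitsDigit r
  expansion-+* q r r<L = trans (expansion-divMod (r + q * L))
    (cong₂ (λ q′ r′ → map shiftExponent (expansion L q′) ++ unitsDigit r′) (/-+* q r r<L) (%-+* q r r<L))

  tailSum-expansion : ∀ m → tailSum L (expansion L m) ≡ m
  tailSum-expansion = <-rec _ value
    where
    value : ∀ m → (∀ {q} → q < m → tailSum L (expansion L q) ≡ q) → tailSum L (expansion L m) ≡ m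
    value zero    _   = refl
    value (suc m) rec = begin
      tailSum L (expansion L (suc m))                                     ≡⟨ cong (tailSum L) (expansion-divMod (suc m)) ⟩
      tailSum L (map shiftExponent (expansion L q) ++ unitsDigit r)        ≡⟨ tailSum-++ L (map shiftExponent (expansion L q)) (unitsDigit r) ⟩
      tailSum L (map shiftExponent (expansion L q)) + tailSum L (unitsDigit r)
        ≡⟨ cong₂ _+_ (tailSum-shift L (expansion L q)) (tailSum-unitsDigit L r) ⟩
      L * tailSum L (expansion L q) + r                                   ≡⟨ cong (λ t → L * t + r) (rec (quotient-< m)) ⟩
      L * q + r                                                           ≡⟨ +-comm (L * q) r ⟩
      r + L * q                                                           ≡⟨ cong (r +_) (*-comm L q) ⟩
      r + q * L                                                           ≡⟨ m≡m%n+[m/n]*n (suc m) L ⟨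
      suc m                                                               ∎
      where open ≡-Reasoning
            q = suc m / L
            r = suc m % L

  digitSum-+* : ∀ q r → r < L → digitSum (r + q * L) ≡ r + digitSum q
  digitSum-+* q r r<L = begin
    sumDigits (expansion L (r + q * L))                                  ≡⟨ cong sumDigits (expansion-+* q r r<L) ⟩
    sumDigits (map shiftExponent (expansion L q) ++ unitsDigit r)         ≡⟨ sumDigits-++ (map shiftExponent (expansion L q)) (unitsDigit r) ⟩
    sumDigits (map shiftExponent (expansion L q)) + sumDigits (unitsDigit r)
      ≡⟨ cong₂ _+_ (sumDigits-shift (expansion L q)) (sumDigits-unitsDigit r) ⟩
    digitSum q + r                                                       ≡⟨ +-comm (digitSum q) r ⟩
    r + digitSum q                                                       ∎
    where open ≡-Reasoning

  ex-+* : ∀ q r → r < L → ex L (r + q * L) ≡ L * ex L q + ℓ * L * q + (r ∸ 1) * r + 2 * digitSum q * r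
  ex-+* q r r<L = begin
    exList L (expansion L (r + q * L))                                   ≡⟨ cong (exList L) (expansion-+* q r r<L) ⟩
    exList L (map shiftExponent E ++ unitsDigit r)                       ≡⟨ exList-++ L (map shiftExponent E) (unitsDigit r) ⟩
    exList L (map shiftExponent E) + exList L (unitsDigit r) + 2 * sumDigits (map shiftExponent E) * tailSum L (unitsDigit r)
      ≡⟨ cong₂ (λ x s → x + exList L (unitsDigit r) + 2 * s * tailSum L (unitsDigit r)) (exList-shift L E) (sumDigits-shift E) ⟩
    L * ex L q + ℓ * L * tailSum L E + exList L (unitsDigit r) + 2 * digitSum q * tailSum L (unitsDigit r)
      ≡⟨ cong₂ (λ t u → L * ex L q + ℓ * L * t + exList L (unitsDigit r) + 2 * digitSum q * u)
               (tailSum-expansion q) (tailSum-unitsDigit L r) ⟩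
    L * ex L q + ℓ * L * q + exList L (unitsDigit r) + 2 * digitSum q * r
      ≡⟨ cong (λ u → L * ex L q + ℓ * L * q + u + 2 * digitSum q * r) (exList-unitsDigit L r) ⟩
    L * ex L q + ℓ * L * q + (r ∸ 1) * r + 2 * digitSum q * r             ∎
    where open ≡-Reasoning
          E = expansion L q

  ExSuc : ℕ → Set
  ExSuc m = ex L (suc m) ≡ ex L m + 2 * digitSum m

  ex-suc-no-carry : ∀ q r → suc r < L → ExSuc (r + q * L)
  ex-suc-no-carry q r 1+r<L = begin
    ex L (suc r + q * L)                                ≡⟨ ex-+* q (suc r) 1+r<L ⟩
    A + r * suc r + 2 * digitSum q * suc r              ≡⟨ cong (λ u → A + u + 2 * digitSum q * suc r) (r*[1+r]≡[r∸1]*r+2r r) ⟩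
    A + ((r ∸ 1) * r + 2 * r) + 2 * digitSum q * suc r  ≡⟨ no-carry-identity A ((r ∸ 1) * r) (digitSum q) r ⟩
    A + (r ∸ 1) * r + 2 * digitSum q * r + 2 * (r + digitSum q)
      ≡⟨ cong₂ _+_ (ex-+* q r r<L) (cong (2 *_) (digitSum-+* q r r<L)) ⟨
    ex L (r + q * L) + 2 * digitSum (r + q * L)         ∎
    where open ≡-Reasoning
          A = L * ex L q + ℓ * L * q
          r<L = <-trans (n<1+n r) 1+r<L

  -- suc (ℓ + q * L) and 0 + suc q * L are definitionally equal.
  ex-suc-carry : ∀ q → ExSuc q → ExSuc (ℓ + q * L)
  ex-suc-carry q ih = begin
    ex L (0 + suc q * L)
      ≡⟨ ex-+* (suc q) 0 (s≤s z≤n) ⟩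
    L * ex L (suc q) + ℓ * L * suc q + 0 + 2 * digitSum (suc q) * 0
      ≡⟨ cong (λ e → L * e + ℓ * L * suc q + 0 + 2 * digitSum (suc q) * 0) ih ⟩
    L * (ex L q + 2 * digitSum q) + ℓ * L * suc q + 0 + 2 * digitSum (suc q) * 0
      ≡⟨ carry-identity k q (ex L q) (digitSum q) (digitSum (suc q)) ⟩
    L * ex L q + ℓ * L * q + k * ℓ + 2 * digitSum q * ℓ + 2 * (ℓ + digitSum q)
      ≡⟨ cong₂ _+_ (ex-+* q ℓ ≤-refl) (cong (2 *_) (digitSum-+* q ℓ ≤-refl)) ⟨
    ex L (ℓ + q * L) + 2 * digitSum (ℓ + q * L)
      ∎
    where open ≡-Reasoning

  ex-suc-+* : ∀ q r → r < L → (q < r + q * L → ExSuc q) → ExSuc (r + q * L)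
  ex-suc-+* q r r<L ih with m≤n⇒m<n∨m≡n r<L
  ... | inj₁ 1+r<L = ex-suc-no-carry q r 1+r<L
  ... | inj₂ refl  = ex-suc-carry q (ih (s≤s (≤-trans (m≤m*n q L) (m≤n+m (q * L) k))))

  ex-suc : ∀ m → ex L (suc m) ≡ ex L m + 2 * digitSum m
  ex-suc = <-rec ExSuc step
    where
    step : ∀ m → (∀ {q} → q < m → ExSuc q) → ExSuc m
    step m rec = subst ExSuc (sym m≡r+q*L) (ex-suc-+* q r (m%n<n m L) (rec ∘ subst (q <_) (sym m≡r+q*L)))
      where q = m / L
            r = m % L
            m≡r+q*L = m≡m%n+[m/n]*n m L

  digitSum-< : ∀ j m → m < L ^ j → digitSum m ≤ ℓ * j
  digitSum-< zero    zero    _         = z≤n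
  digitSum-< zero    (suc m) (s≤s ())
  digitSum-< (suc j) m       m<L^[1+j] = begin
    digitSum m                           ≡⟨ cong digitSum (m≡m%n+[m/n]*n m L) ⟩
    digitSum (m % L + m / L * L)         ≡⟨ digitSum-+* (m / L) (m % L) (m%n<n m L) ⟩
    m % L + digitSum (m / L)             ≤⟨ +-mono-≤ (≤-pred (m%n<n m L)) (digitSum-< j (m / L) (m<n*o⇒m/o<n m<L^j*L)) ⟩
    ℓ + ℓ * j                            ≡⟨ *-suc ℓ j ⟨
    ℓ * suc j                            ∎
    where open ≤-Reasoning
          m<L^j*L = subst (m <_) (*-comm L (L ^ j)) m<L^[1+j]

  twice-digitSum-≤ : ∀ n m → m < L ^ (n / 2) → 2 * digitSum m ≤ ℓ * n
  twice-digitSum-≤ n m m<L^[n/2] = begin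
    2 * digitSum m         ≤⟨ *-monoʳ-≤ 2 (digitSum-< (n / 2) m m<L^[n/2]) ⟩
    2 * (ℓ * (n / 2))      ≡⟨ *-comm 2 (ℓ * (n / 2)) ⟩
    ℓ * (n / 2) * 2        ≡⟨ *-assoc ℓ (n / 2) 2 ⟩
    ℓ * (n / 2 * 2)        ≤⟨ *-monoʳ-≤ ℓ (m/n*n≤m n 2) ⟩
    ℓ * n                  ∎
    where open ≤-Reasoning

open ℤ using (+_)

module _ (k : ℕ) where
  open Radix k

  ξ-suc-difference : ∀ n m → ξ L n (suc m) ℤ.- ξ L n m ≡ + (ℓ * n) ℤ.- + (2 * digitSum m)
  ξ-suc-difference n m = begin
    (+ (ℓ * n * suc m) ℤ.- + ex L (suc m)) ℤ.- ξ L n m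
      ≡⟨ cong₂ (λ a b → (+ a ℤ.- + b) ℤ.- ξ L n m) (*-suc (ℓ * n) m) (ex-suc m) ⟩
    (+ (ℓ * n + ℓ * n * m) ℤ.- + (ex L m + 2 * digitSum m)) ℤ.- ξ L n m
      ≡⟨ cong₂ (λ a b → (a ℤ.- b) ℤ.- ξ L n m) (ℤP.pos-+ (ℓ * n) (ℓ * n * m)) (ℤP.pos-+ (ex L m) (2 * digitSum m)) ⟩
    (+ (ℓ * n) ℤ.+ + (ℓ * n * m) ℤ.- (+ ex L m ℤ.+ + (2 * digitSum m))) ℤ.- (+ (ℓ * n * m) ℤ.- + ex L m)
      ≡⟨ difference-identity (+ (ℓ * n)) (+ (2 * digitSum m)) (+ (ℓ * n * m)) (+ ex L m) ⟩
    + (ℓ * n) ℤ.- + (2 * digitSum m)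
      ∎
    where open ≡-Reasoning

mainTheorem2 : (L n : ℕ) → .{{_ : NonZero L}} → 2 ≤ L → 2 ≤ n →
    (m : ℕ) → 1 ≤ m → m < L ^ (n / 2) →
    + 0 ℤ.≤ ξ L n (suc m) ℤ.- ξ L n m
mainTheorem2 zero          n ()
mainTheorem2 (suc zero)    n (s≤s ())
mainTheorem2 (suc (suc k)) n _ _ m _ m<L^[n/2] =
  subst (+ 0 ℤ.≤_) (sym (ξ-suc-difference k n m)) (ℤP.i≤j⇒0≤j-i (ℤ.+≤+ (twice-digitSum-≤ n m m<L^[n/2])))
  where open Radix k
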